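{- Every d-sequent derivable in the dyadic calculus $!_{\mathrm d}\mathbf{ACT}_\omega^{\mathrm m}$ can be derived in it without using the rules $(\mathrm{Cut})_{\mathrm d1}$ and $(\mathrm{Cut})_{\mathrm d2}$.
   Context: Formulas are built from a countable set of variables and constants $0,1$ using binary $\backslash$, $/$, $\cdot$, $\oplus$, $\&$, unary postfix ${}^*$ and unary prefix $!$. A monoidal implication is a formula $(b_1\cdot\ldots\cdot b_n)\backslash(c_1\cdot\ldots\cdot c_m)$ with $n,m\ge0$ and $b_i,c_j$ variables (an empty product stands for $1$). Only formulas in which every subformula of the form $!B$ has $B$ a monoidal implication are considered. A d-sequent is an expression $!\Xi;\Gamma\Rightarrow C$ where $C$ is a formula, $\Gamma$ a finite (possibly empty) sequence of formulas, and $!\Xi$ a finite set of formulas $!B$ with $B$ a monoidal implication. $A^n$ denotes $n$ copies of $A$. The calculus $!_{\mathrm d}\mathbf{ACT}_\omega^{\mathrm m}$ consists of the following, where in each case the same $!\Xi$ is prefixed to the antecedent of all premises and of the conclusion. Axioms: $!\Xi;A\Rightarrow A$; $\ !\Xi;\ \Rightarrow1$; $\ !\Xi;\Gamma,0,\Delta\Rightarrow C$; $\ !\Xi;\ \Rightarrow A^*$. Rules (premises / conclusion): ($\backslash L$) $!\Xi;\Pi\Rightarrow A$, $!\Xi;\Gamma,B,\Delta\Rightarrow C$ / $!\Xi;\Gamma,\Pi,A\backslash B,\Delta\Rightarrow C$; ($\backslash R$) $!\Xi;A,\Pi\Rightarrow B$ / $!\Xi;\Pi\Rightarrow A\backslash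 B$; ($/L$) $!\Xi;\Pi\Rightarrow A$, $!\Xi;\Gamma,B,\Delta\Rightarrow C$ / $!\Xi;\Gamma,B/A,\Pi,\Delta\Rightarrow C$; ($/R$) $!\Xi;\Pi,A\Rightarrow B$ / $!\Xi;\Pi\Rightarrow B/A$; ($\cdot L$) $!\Xi;\Gamma,A,B,\Delta\Rightarrow C$ / $!\Xi;\Gamma,A\cdot B,\Delta\Rightarrow C$; ($\cdot R$) $!\Xi;\Gamma\Rightarrow A$, $!\Xi;\Delta\Rightarrow B$ / $!\Xi;\Gamma,\Delta\Rightarrow A\cdot B$; ($1L$) $!\Xi;\Gamma,\Delta\Rightarrow C$ / $!\Xi;\Gamma,1,\Delta\Rightarrow C$; ($\oplus L$) $!\Xi;\Gamma,A_1,\Delta\Rightarrow C$, $!\Xi;\Gamma,A_2,\Delta\Rightarrow C$ / $!\Xi;\Gamma,A_1\oplus A_2,\Delta\Rightarrow C$; ($\oplus R_i$) $!\Xi;\Pi\Rightarrow A_i$ / $!\Xi;\Pi\Rightarrow A_1\oplus A_2$; ($\&L_i$) $!\Xi;\Gamma,A_i,\Delta\Rightarrow C$ / $!\Xi;\Gamma,A_1\&A_2,\Delta\Rightarrow C$; ($\&R$) $!\Xi;\Pi\Rightarrow A_1$, $!\Xi;\Pi\Rightarrow A_2$ / $!\Xi;\Pi\Rightarrow A_1\&A_2$; (${}^*L_\omega$) $(!\Xi;\Gamma,A^n,\Delta\Rightarrow C)_{n\in\omega}$ / $!\Xi;\Gamma,A^*,\Delta\Rightarrow C$; (${}^*R_n$,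 $n\ge1$) $!\Xi;\Pi_1\Rightarrow A,\dots,!\Xi;\Pi_n\Rightarrow A$ / $!\Xi;\Pi_1,\dots,\Pi_n\Rightarrow A^*$; $(!L)_{\mathrm d}$ $!\Xi\cup\{!A\};\Gamma,\Delta\Rightarrow C$ / $!\Xi;\Gamma,!A,\Delta\Rightarrow C$; $(!R)_{\mathrm d}$ $!\Xi;\ \Rightarrow B$ / $!\Xi;\ \Rightarrow!B$; $(A)_{\mathrm d}$ $!\Xi;\Gamma,c_1,\dots,c_m,\Delta\Rightarrow C$ / $\{!((b_1\cdot\ldots\cdot b_n)\backslash(c_1\cdot\ldots\cdot c_m))\}\cup!\Xi;\Gamma,b_1,\dots,b_n,\Delta\Rightarrow C$; $(\mathrm{Cut})_{\mathrm d1}$ $!\Xi;\Pi\Rightarrow A$, $!\Xi;\Gamma,A,\Delta\Rightarrow C$ / $!\Xi;\Gamma,\Pi,\Delta\Rightarrow C$; $(\mathrm{Cut})_{\mathrm d2}$ $!\Xi;\ \Rightarrow B$, $!\Xi\cup\{!B\};\Gamma\Rightarrow C$ / $!\Xi;\Gamma\Rightarrow C$. Derivable d-sequents form the least set containing the axioms and closed under the rules (derivations are well-founded, possibly infinite trees). -}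

module Defs where

open import Data.Nat using (ℕ)
open import Data.Bool using (Bool; true; false)
open import Data.List using (List; []; _∷_; _++_; map; replicate; concat)
open import Data.List.Relation.Unary.All using (All)
open import Data.List.Membership.Propositional using (_∈_)
open import Data.Product using (_×_)

-- Monoidal implication (b₁·…·bₙ)\(c₁·…·cₘ), given by its two lists of variables.
data MonImp : Set where
  mi : List ℕ → List ℕ → MonImp

-- Formulas.  The prefix ! is only applied to monoidal implications
-- (the paper only considers such formulas).
infixr 30 _·_
infixr 25 _\\_ _//_ _⊕_ _&_
infix 40 _*
infix 45 !_
data Formula : Set where
  var  : ℕ → Formula
  𝟎 𝟏  : Formula
  _\\_ : Formula → Formula → Formula
  _//_ : Formula → Formula → Formula
  _·_  : Formula → Formula → Formula
  _⊕_  : Formula → Formula → Formula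
  _&_  : Formula → Formula → Formula
  _*   : Formula → Formula
  !_   : MonImp → Formula

prod : List ℕ → Formula
prod []            = 𝟏
prod (b ∷ [])      = var b
prod (b ∷ b' ∷ bs) = var b · prod (b' ∷ bs)

⌜_⌝ : MonImp → Formula
⌜ mi bs cs ⌝ = prod bs \\ prod cs

vars : List ℕ → List Formula
vars = map var

-- The set !Ξ is represented by a list of monoidal implications, read as a
-- finite set: set equality of lists.
_≈ˢ_ : List MonImp → List MonImp → Set
Ξ ≈ˢ Ξ' = ∀ x → (x ∈ Ξ → x ∈ Ξ') × (x ∈ Ξ' → x ∈ Ξ)

infix 4 _⊢_∣_⇒_

-- Derivations of d-sequents !Ξ;Γ ⇒ C in !_d ACT_ω^m.
-- The Bool index says whether cut rules may be used (true) or not (false).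
data _⊢_∣_⇒_ : Bool → List MonImp → List Formula → Formula → Set where
  ax    : ∀ {c Ξ A} → c ⊢ Ξ ∣ A ∷ [] ⇒ A
  1R    : ∀ {c Ξ} → c ⊢ Ξ ∣ [] ⇒ 𝟏
  0L    : ∀ {c Ξ Γ Δ C} → c ⊢ Ξ ∣ Γ ++ 𝟎 ∷ Δ ⇒ C
  *R0   : ∀ {c Ξ A} → c ⊢ Ξ ∣ [] ⇒ A *
  \\L   : ∀ {c Ξ Γ Π Δ A B C} → c ⊢ Ξ ∣ Π ⇒ A → c ⊢ Ξ ∣ Γ ++ B ∷ Δ ⇒ C →
          c ⊢ Ξ ∣ Γ ++ Π ++ (A \\ B) ∷ Δ ⇒ C
  \\R   : ∀ {c Ξ Π A B} → c ⊢ Ξ ∣ A ∷ Π ⇒ B → c ⊢ Ξ ∣ Π ⇒ A \\ B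
  //L   : ∀ {c Ξ Γ Π Δ A B C} → c ⊢ Ξ ∣ Π ⇒ A → c ⊢ Ξ ∣ Γ ++ B ∷ Δ ⇒ C →
          c ⊢ Ξ ∣ Γ ++ (B // A) ∷ Π ++ Δ ⇒ C
  //R   : ∀ {c Ξ Π A B} → c ⊢ Ξ ∣ Π ++ A ∷ [] ⇒ B → c ⊢ Ξ ∣ Π ⇒ B // A
  ·L    : ∀ {c Ξ Γ Δ A B C} → c ⊢ Ξ ∣ Γ ++ A ∷ B ∷ Δ ⇒ C →
          c ⊢ Ξ ∣ Γ ++ (A · B) ∷ Δ ⇒ C
  ·R    : ∀ {c Ξ Γ Δ A B} → c ⊢ Ξ ∣ Γ ⇒ A → c ⊢ Ξ ∣ Δ ⇒ B → c ⊢ Ξ ∣ Γ ++ Δ ⇒ A · B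
  1L    : ∀ {c Ξ Γ Δ C} → c ⊢ Ξ ∣ Γ ++ Δ ⇒ C → c ⊢ Ξ ∣ Γ ++ 𝟏 ∷ Δ ⇒ C
  ⊕L    : ∀ {c Ξ Γ Δ A₁ A₂ C} → c ⊢ Ξ ∣ Γ ++ A₁ ∷ Δ ⇒ C → c ⊢ Ξ ∣ Γ ++ A₂ ∷ Δ ⇒ C →
          c ⊢ Ξ ∣ Γ ++ (A₁ ⊕ A₂) ∷ Δ ⇒ C
  ⊕R₁   : ∀ {c Ξ Π A₁ A₂} → c ⊢ Ξ ∣ Π ⇒ A₁ → c ⊢ Ξ ∣ Π ⇒ A₁ ⊕ A₂
  ⊕R₂   : ∀ {c Ξ Π A₁ A₂} → c ⊢ Ξ ∣ Π ⇒ A₂ → c ⊢ Ξ ∣ Π ⇒ A₁ ⊕ A₂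
  &L₁   : ∀ {c Ξ Γ Δ A₁ A₂ C} → c ⊢ Ξ ∣ Γ ++ A₁ ∷ Δ ⇒ C → c ⊢ Ξ ∣ Γ ++ (A₁ & A₂) ∷ Δ ⇒ C
  &L₂   : ∀ {c Ξ Γ Δ A₁ A₂ C} → c ⊢ Ξ ∣ Γ ++ A₂ ∷ Δ ⇒ C → c ⊢ Ξ ∣ Γ ++ (A₁ & A₂) ∷ Δ ⇒ C
  &R    : ∀ {c Ξ Π A₁ A₂} → c ⊢ Ξ ∣ Π ⇒ A₁ → c ⊢ Ξ ∣ Π ⇒ A₂ → c ⊢ Ξ ∣ Π ⇒ A₁ & A₂
  *Lω   : ∀ {c Ξ Γ Δ A C} → (∀ n → c ⊢ Ξ ∣ Γ ++ replicate n A ++ Δ ⇒ C) →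
          c ⊢ Ξ ∣ Γ ++ (A *) ∷ Δ ⇒ C
  -- (*R_n), n ≥ 1: premises Π₁ ⇒ A, …, Πₙ ⇒ A (the list Π ∷ Πs has n ≥ 1 entries)
  *Rn   : ∀ {c Ξ A} (Π : List Formula) (Πs : List (List Formula)) →
          c ⊢ Ξ ∣ Π ⇒ A → All (λ Π' → c ⊢ Ξ ∣ Π' ⇒ A) Πs →
          c ⊢ Ξ ∣ Π ++ concat Πs ⇒ A *
  !L    : ∀ {c Ξ Ξ' Γ Δ C} (m : MonImp) → Ξ' ≈ˢ (m ∷ Ξ) →
          c ⊢ Ξ' ∣ Γ ++ Δ ⇒ C → c ⊢ Ξ ∣ Γ ++ (! m) ∷ Δ ⇒ C
  !R    : ∀ {c Ξ} (m : MonImp) → c ⊢ Ξ ∣ [] ⇒ ⌜ m ⌝ → c ⊢ Ξ ∣ [] ⇒ ! m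
  Ad    : ∀ {c Ξ Ξ' Γ Δ C} (bs cs : List ℕ) → Ξ' ≈ˢ (mi bs cs ∷ Ξ) →
          c ⊢ Ξ ∣ Γ ++ vars cs ++ Δ ⇒ C → c ⊢ Ξ' ∣ Γ ++ vars bs ++ Δ ⇒ C
  cut1  : ∀ {Ξ Γ Π Δ A C} → true ⊢ Ξ ∣ Π ⇒ A → true ⊢ Ξ ∣ Γ ++ A ∷ Δ ⇒ C →
          true ⊢ Ξ ∣ Γ ++ Π ++ Δ ⇒ C
  cut2  : ∀ {Ξ Ξ' Γ C} (m : MonImp) → Ξ' ≈ˢ (m ∷ Ξ) →
          true ⊢ Ξ ∣ [] ⇒ ⌜ m ⌝ → true ⊢ Ξ' ∣ Γ ⇒ C → true ⊢ Ξ ∣ Γ ⇒ C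

Derivable : List MonImp → List Formula → Formula → Set
Derivable Ξ Γ C = true ⊢ Ξ ∣ Γ ⇒ C

CutFreeDerivable : List MonImp → List Formula → Formula → Set
CutFreeDerivable Ξ Γ C = false ⊢ Ξ ∣ Γ ⇒ C

-- Gentzen-style cut elimination, by recursion on the cut formula and on the two premises; the
-- ω-rule is one more constructor, so well-founded infinite derivations are handled by structural
-- recursion. A cut is pushed into its left premise until that premise ends in a right rule, then
-- into its right premise until the cut formula is principal there, where it is replaced by cuts on
-- immediate subformulas. A principal cut of *Rₙ against *Lω cuts the n premises of *Rₙ into the
-- n-th premise of *Lω. A principal cut on ! m, and likewise (Cut)_d2, is removed by discharging ! m
-- from the !-context: each use of (A)_d for m becomes a cut on ⌜ m ⌝ = (b₁⋯bₙ)\(c₁⋯cₘ) against the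
-- given derivation of ⌜ m ⌝.
{-# OPTIONS --safe #-}
module Submission where

open import Defs
open import Data.Bool using (Bool; true; false; if_then_else_)
open import Data.Empty using (⊥; ⊥-elim)
open import Data.Unit using (⊤; tt)
open import Data.List using (List; []; _∷_; _++_; [_]; replicate; concat; length)
open import Data.List.Properties using (++-assoc; ++-identityʳ; ++-conicalʳ; ∷-injective)
open import Data.List.Relation.Unary.All as All using (All; []; _∷_)
open import Data.List.Relation.Unary.Any using (here; there)
open import Data.List.Membership.Propositional using (_∈_)
open import Data.List.Membership.Propositional.Properties using (∈-insert; ∈-map⁻)
open import Data.List.Relation.Binary.Subset.Propositional using (_⊆_)
open import Data.List.Relation.Binary.Subset.Propositional.Properties
  using (⊆-refl; ⊆-trans; xs⊆x∷xs; ∷⁺ʳ)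
open import Data.Product using (Σ-syntax; _×_; _,_; proj₁; proj₂)
open import Data.Sum as Sum using (_⊎_; inj₁; inj₂)
open import Relation.Binary.PropositionalEquality using (_≡_; _≢_; refl; sym; trans; cong)

≈ˢ⇒⊆ : ∀ {Ξ Ξ'} → Ξ ≈ˢ Ξ' → Ξ ⊆ Ξ'
≈ˢ⇒⊆ e {x} = proj₁ (e x)

≈ˢ⇒⊇ : ∀ {Ξ Ξ'} → Ξ ≈ˢ Ξ' → Ξ' ⊆ Ξ
≈ˢ⇒⊇ e {x} = proj₂ (e x)

≈ˢ-refl : ∀ {Ξ} → Ξ ≈ˢ Ξ
≈ˢ-refl x = (λ p → p) , (λ p → p)

∈⇒≈ˢ∷ : ∀ {m Ξ} → m ∈ Ξ → Ξ ≈ˢ (m ∷ Ξ)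
∈⇒≈ˢ∷ m∈Ξ x = there , λ { (here refl) → m∈Ξ ; (there p) → p }

≈ˢ∷⇒∈ : ∀ {m Ξ Ξ'} → Ξ' ≈ˢ (m ∷ Ξ) → m ∈ Ξ'
≈ˢ∷⇒∈ e = ≈ˢ⇒⊇ e (here refl)

≈ˢ∷⇒⊇ : ∀ {m Ξ Ξ'} → Ξ' ≈ˢ (m ∷ Ξ) → Ξ ⊆ Ξ'
≈ˢ∷⇒⊇ e p = ≈ˢ⇒⊇ e (there p)

≈ˢ∷⇒⊆∷ : ∀ {m Ξ Ξ' Ξ''} → Ξ' ≈ˢ (m ∷ Ξ) → Ξ ⊆ Ξ'' → Ξ' ⊆ m ∷ Ξ''
≈ˢ∷⇒⊆∷ {m} e s = ⊆-trans (≈ˢ⇒⊆ e) (∷⁺ʳ m s)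

cast : ∀ {c Ξ Θ Θ' C} → Θ ≡ Θ' → c ⊢ Ξ ∣ Θ ⇒ C → c ⊢ Ξ ∣ Θ' ⇒ C
cast refl d = d

[]≢++∷ : ∀ (Γ : List Formula) {A Δ} → [] ≢ Γ ++ A ∷ Δ
[]≢++∷ Γ e with ++-conicalʳ Γ _ (sym e)
... | ()

++-assoc₄ : ∀ (W X Y Z : List Formula) → (W ++ X ++ Y) ++ Z ≡ W ++ X ++ Y ++ Z
++-assoc₄ W X Y Z = trans (++-assoc W (X ++ Y) Z) (cong (W ++_) (++-assoc X Y Z))

++-frame : ∀ (Γ Γ₁ Y Δ₁ Δ : List Formula) →
           Γ ++ (Γ₁ ++ Y ++ Δ₁) ++ Δ ≡ (Γ ++ Γ₁) ++ Y ++ Δ₁ ++ Δ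
++-frame Γ Γ₁ Y Δ₁ Δ = trans (cong (Γ ++_) (++-assoc₄ Γ₁ Y Δ₁ Δ)) (sym (++-assoc Γ Γ₁ _))

data Apart (Xs Γ₁ Δ₁ Γ : List Formula) (A : Formula) (Δ : List Formula) : Set where
  before : ∀ M → Γ₁ ≡ Γ ++ A ∷ M → Δ ≡ M ++ Xs ++ Δ₁ → Apart Xs Γ₁ Δ₁ Γ A Δ
  after  : ∀ M → Δ₁ ≡ M ++ A ∷ Δ → Γ ≡ Γ₁ ++ Xs ++ M → Apart Xs Γ₁ Δ₁ Γ A Δ

data Inside (Xs Γ₁ Δ₁ Γ : List Formula) (A : Formula) (Δ : List Formula) : Set where
  inside : ∀ M₁ M₂ → Xs ≡ M₁ ++ A ∷ M₂ → Γ ≡ Γ₁ ++ M₁ → Δ ≡ M₂ ++ Δ₁ →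
           Inside Xs Γ₁ Δ₁ Γ A Δ

split : ∀ Γ₁ Δ₁ Γ A Δ → Γ₁ ++ Δ₁ ≡ Γ ++ A ∷ Δ → Apart [] Γ₁ Δ₁ Γ A Δ
split []       Δ₁ Γ       A Δ eq = after Γ eq refl
split (B ∷ Γ₁) Δ₁ []      A Δ eq with ∷-injective eq
... | refl , refl = before Γ₁ refl refl
split (B ∷ Γ₁) Δ₁ (_ ∷ Γ) A Δ eq with ∷-injective eq
... | refl , eq′ with split Γ₁ Δ₁ Γ A Δ eq′
...   | before M refl refl = before M refl refl
...   | after  M refl refl = after M refl refl

locate : ∀ Γ₁ Xs Δ₁ Γ A Δ → Γ₁ ++ Xs ++ Δ₁ ≡ Γ ++ A ∷ Δ →
         Apart Xs Γ₁ Δ₁ Γ A Δ ⊎ Inside Xs Γ₁ Δ₁ Γ A Δ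
locate Γ₁ Xs Δ₁ Γ A Δ eq with split Γ₁ (Xs ++ Δ₁) Γ A Δ eq
... | before M refl refl = inj₁ (before M refl refl)
... | after  M e    refl with split Xs Δ₁ M A Δ e
...   | before M′ refl refl = inj₂ (inside M M′ refl refl refl)
...   | after  M′ refl refl = inj₁ (after M′ refl refl)

inside-++ : ∀ Xs {Ys Γ₁ Δ₁ Γ A Δ} → Inside (Xs ++ Ys) Γ₁ Δ₁ Γ A Δ →
            Inside Xs Γ₁ (Ys ++ Δ₁) Γ A Δ ⊎ Inside Ys (Γ₁ ++ Xs) Δ₁ Γ A Δ
inside-++ Xs {Ys} (inside M₁ M₂ e refl refl) with split Xs Ys M₁ _ M₂ e
... | before M refl refl = inj₁ (inside M₁ M refl refl (++-assoc M Ys _))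
... | after  M refl refl = inj₂ (inside M M₂ refl (sym (++-assoc _ Xs M)) refl)

inside-[-] : ∀ {X Γ₁ Δ₁ Γ A Δ} → Inside [ X ] Γ₁ Δ₁ Γ A Δ → Γ ≡ Γ₁ × A ≡ X × Δ ≡ Δ₁
inside-[-] (inside []       []      refl refl refl) = ++-identityʳ _ , refl , refl
inside-[-] (inside []       (_ ∷ _) ()   _    _)
inside-[-] (inside (_ ∷ M₁) _       e    _    _) =
  ⊥-elim ([]≢++∷ M₁ (proj₂ (∷-injective e)))

inside⇒∈ : ∀ {Xs Γ₁ Δ₁ Γ A Δ} → Inside Xs Γ₁ Δ₁ Γ A Δ → A ∈ Xs
inside⇒∈ (inside M₁ _ refl _ _) = ∈-insert M₁

locate₁ : ∀ Γ₁ {X} Δ₁ Γ {A} Δ → Γ₁ ++ X ∷ Δ₁ ≡ Γ ++ A ∷ Δ →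
          Apart [ X ] Γ₁ Δ₁ Γ A Δ ⊎ (Γ ≡ Γ₁ × A ≡ X × Δ ≡ Δ₁)
locate₁ Γ₁ Δ₁ Γ Δ eq = Sum.map₂ inside-[-] (locate Γ₁ _ Δ₁ Γ _ Δ eq)

locate\\ : ∀ Γ₁ Π₁ {X} Δ₁ Γ {A} Δ → Γ₁ ++ Π₁ ++ X ∷ Δ₁ ≡ Γ ++ A ∷ Δ →
           Apart (Π₁ ++ [ X ]) Γ₁ Δ₁ Γ A Δ ⊎ Inside Π₁ Γ₁ (X ∷ Δ₁) Γ A Δ
             ⊎ (Γ ≡ Γ₁ ++ Π₁ × A ≡ X × Δ ≡ Δ₁)
locate\\ Γ₁ Π₁ Δ₁ Γ Δ eq
  with locate Γ₁ (Π₁ ++ [ _ ]) Δ₁ Γ _ Δ (trans (cong (Γ₁ ++_) (++-assoc Π₁ _ Δ₁)) eq)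
... | inj₁ a = inj₁ a
... | inj₂ i = inj₂ (Sum.map₂ inside-[-] (inside-++ Π₁ i))

locate// : ∀ Γ₁ {X} Π₁ Δ₁ Γ {A} Δ → Γ₁ ++ X ∷ Π₁ ++ Δ₁ ≡ Γ ++ A ∷ Δ →
           Apart (X ∷ Π₁) Γ₁ Δ₁ Γ A Δ ⊎ Inside Π₁ (Γ₁ ++ [ X ]) Δ₁ Γ A Δ
             ⊎ (Γ ≡ Γ₁ × A ≡ X × Δ ≡ Π₁ ++ Δ₁)
locate// Γ₁ Π₁ Δ₁ Γ Δ eq with locate Γ₁ (_ ∷ Π₁) Δ₁ Γ _ Δ eq
... | inj₁ a = inj₁ a
... | inj₂ i = inj₂ (Sum.swap (Sum.map₁ inside-[-] (inside-++ [ _ ] i)))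

-- Stated for all extensions of Ξ, so that it survives the growth of the !-context under (!L)_d.
AdRuleAdmissible : Bool → List MonImp → MonImp → Set
AdRuleAdmissible c Ξ (mi bs cs) = ∀ {Ξ'} → Ξ ⊆ Ξ' → ∀ Γ Δ {C} →
  c ⊢ Ξ' ∣ Γ ++ vars cs ++ Δ ⇒ C → c ⊢ Ξ' ∣ Γ ++ vars bs ++ Δ ⇒ C

AdRulesAdmissible : Bool → List MonImp → List MonImp → Set
AdRulesAdmissible c Ξ' Ξ = ∀ {m} → m ∈ Ξ → AdRuleAdmissible c Ξ' m

AdRuleAdmissible-mono : ∀ {c Ξ Ξ' m} → Ξ ⊆ Ξ' → AdRuleAdmissible c Ξ m → AdRuleAdmissible c Ξ' m
AdRuleAdmissible-mono {m = mi _ _} s adm s′ = adm (⊆-trans s s′)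

∈⇒AdRuleAdmissible : ∀ {c Ξ m} → m ∈ Ξ → AdRuleAdmissible c Ξ m
∈⇒AdRuleAdmissible {m = mi bs cs} m∈Ξ s Γ Δ = Ad {Γ = Γ} {Δ = Δ} bs cs (∈⇒≈ˢ∷ (s m∈Ξ))

∷-AdRulesAdmissible : ∀ {c Ξ Ξ' m} → AdRuleAdmissible c Ξ' m → AdRulesAdmissible c Ξ' Ξ →
                      AdRulesAdmissible c Ξ' (m ∷ Ξ)
∷-AdRulesAdmissible adm h (here refl) = adm
∷-AdRulesAdmissible adm h (there p)   = h p

AdRulesAdmissible-∷⁺ : ∀ {c Ξ Ξ'} m → AdRulesAdmissible c Ξ' Ξ →
                       AdRulesAdmissible c (m ∷ Ξ') (m ∷ Ξ)
AdRulesAdmissible-∷⁺ m h = ∷-AdRulesAdmissible (∈⇒AdRuleAdmissible (here refl))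
                                               (λ p → AdRuleAdmissible-mono (xs⊆x∷xs _ m) (h p))

mutual
  relocate : ∀ {c Ξ Ξ' Γ C} → AdRulesAdmissible c Ξ' Ξ → c ⊢ Ξ ∣ Γ ⇒ C → c ⊢ Ξ' ∣ Γ ⇒ C
  relocate h ax                               = ax
  relocate h 1R                               = 1R
  relocate h (0L {Γ = Γ} {Δ = Δ})             = 0L {Γ = Γ} {Δ = Δ}
  relocate h *R0                              = *R0
  relocate h (\\L {Γ = Γ} {Π = Π} {Δ = Δ} d e) =
    \\L {Γ = Γ} {Π = Π} {Δ = Δ} (relocate h d) (relocate h e)
  relocate h (\\R d)                          = \\R (relocate h d)
  relocate h (//L {Γ = Γ} {Π = Π} {Δ = Δ} d e) =
    //L {Γ = Γ} {Π = Π} {Δ = Δ} (relocate h d) (relocate h e)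
  relocate h (//R d)                          = //R (relocate h d)
  relocate h (·L {Γ = Γ} {Δ = Δ} d)           = ·L {Γ = Γ} {Δ = Δ} (relocate h d)
  relocate h (·R d e)                         = ·R (relocate h d) (relocate h e)
  relocate h (1L {Γ = Γ} {Δ = Δ} d)           = 1L {Γ = Γ} {Δ = Δ} (relocate h d)
  relocate h (⊕L {Γ = Γ} {Δ = Δ} d e)         = ⊕L {Γ = Γ} {Δ = Δ} (relocate h d) (relocate h e)
  relocate h (⊕R₁ d)                          = ⊕R₁ (relocate h d)
  relocate h (⊕R₂ d)                          = ⊕R₂ (relocate h d)
  relocate h (&L₁ {Γ = Γ} {Δ = Δ} d)          = &L₁ {Γ = Γ} {Δ = Δ} (relocate h d)
  relocate h (&L₂ {Γ = Γ} {Δ = Δ} d)          = &L₂ {Γ = Γ} {Δ = Δ} (relocate h d)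
  relocate h (&R d e)                         = &R (relocate h d) (relocate h e)
  relocate h (*Lω {Γ = Γ} {Δ = Δ} f)          = *Lω {Γ = Γ} {Δ = Δ} (λ n → relocate h (f n))
  relocate h (*Rn Π Πs d ds)                  = *Rn Π Πs (relocate h d) (relocateAll h ds)
  relocate h (!L {Γ = Γ} {Δ = Δ} m e d)       =
    !L {Γ = Γ} {Δ = Δ} m ≈ˢ-refl (relocate (λ p → AdRulesAdmissible-∷⁺ m h (≈ˢ⇒⊆ e p)) d)
  relocate h (!R m d)                         = !R m (relocate h d)
  relocate h (Ad {Γ = Γ} {Δ = Δ} bs cs e d)   =
    h (≈ˢ∷⇒∈ e) ⊆-refl Γ Δ (relocate (λ p → h (≈ˢ∷⇒⊇ e p)) d)
  relocate h (cut1 {Γ = Γ} {Δ = Δ} d e)       = cut1 {Γ = Γ} {Δ = Δ} (relocate h d) (relocate h e)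
  relocate h (cut2 m e d₁ d₂)                 =
    cut2 m ≈ˢ-refl (relocate h d₁) (relocate (λ p → AdRulesAdmissible-∷⁺ m h (≈ˢ⇒⊆ e p)) d₂)

  relocateAll : ∀ {c Ξ Ξ' Πs C} → AdRulesAdmissible c Ξ' Ξ →
                All (λ Π → c ⊢ Ξ ∣ Π ⇒ C) Πs → All (λ Π → c ⊢ Ξ' ∣ Π ⇒ C) Πs
  relocateAll h []       = []
  relocateAll h (d ∷ ds) = relocate h d ∷ relocateAll h ds

weaken : ∀ {c Ξ Ξ' Γ C} → Ξ ⊆ Ξ' → c ⊢ Ξ ∣ Γ ⇒ C → c ⊢ Ξ' ∣ Γ ⇒ C
weaken s = relocate (λ p → ∈⇒AdRuleAdmissible (s p))

discharge : ∀ {c Ξ Ξ' m Γ C} → AdRuleAdmissible c Ξ m → Ξ' ⊆ m ∷ Ξ →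
            c ⊢ Ξ' ∣ Γ ⇒ C → c ⊢ Ξ ∣ Γ ⇒ C
discharge adm s = relocate (λ p → ∷-AdRulesAdmissible adm ∈⇒AdRuleAdmissible (s p))

prodR : ∀ {c Ξ} bs → c ⊢ Ξ ∣ vars bs ⇒ prod bs
prodR []            = 1R
prodR (b ∷ [])      = ax
prodR (b ∷ b′ ∷ bs) = ·R {Γ = [ var b ]} ax (prodR (b′ ∷ bs))

prodL : ∀ {c Ξ C} xs Γ Δ → c ⊢ Ξ ∣ Γ ++ vars xs ++ Δ ⇒ C → c ⊢ Ξ ∣ Γ ++ prod xs ∷ Δ ⇒ C
prodL []            Γ Δ d = 1L {Γ = Γ} {Δ = Δ} d
prodL (x ∷ [])      Γ Δ d = d
prodL (x ∷ x′ ∷ xs) Γ Δ d =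
  ·L {Γ = Γ} {Δ = Δ} (cast (++-assoc Γ [ var x ] _)
    (prodL (x′ ∷ xs) (Γ ++ [ var x ]) Δ (cast (sym (++-assoc Γ [ var x ] _)) d)))

LeftRule : List MonImp → List MonImp → {I : Set} → (I → List Formula) → List Formula →
           Formula → Set
LeftRule Ξ' Ξ Ys Xs C =
  ∀ Γ Δ → (∀ i → false ⊢ Ξ' ∣ Γ ++ Ys i ++ Δ ⇒ C) → false ⊢ Ξ ∣ Γ ++ Xs ++ Δ ⇒ C

0L-rule : ∀ {Ξ C} → LeftRule Ξ Ξ {⊥} (λ ()) [ 𝟎 ] C
0L-rule Γ Δ _ = 0L {Γ = Γ} {Δ = Δ}

1L-rule : ∀ {Ξ C} → LeftRule Ξ Ξ {⊤} (λ _ → []) [ 𝟏 ] C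
1L-rule Γ Δ p = 1L {Γ = Γ} {Δ = Δ} (p tt)

·L-rule : ∀ {Ξ A B C} → LeftRule Ξ Ξ {⊤} (λ _ → A ∷ B ∷ []) [ A · B ] C
·L-rule Γ Δ p = ·L {Γ = Γ} {Δ = Δ} (p tt)

⊕L-rule : ∀ {Ξ A₁ A₂ C} → LeftRule Ξ Ξ (λ b → [ if b then A₁ else A₂ ]) [ A₁ ⊕ A₂ ] C
⊕L-rule Γ Δ p = ⊕L {Γ = Γ} {Δ = Δ} (p true) (p false)

&L₁-rule : ∀ {Ξ A₁ A₂ C} → LeftRule Ξ Ξ {⊤} (λ _ → [ A₁ ]) [ A₁ & A₂ ] C
&L₁-rule Γ Δ p = &L₁ {Γ = Γ} {Δ = Δ} (p tt)

&L₂-rule : ∀ {Ξ A₁ A₂ C} → LeftRule Ξ Ξ {⊤} (λ _ → [ A₂ ]) [ A₁ & A₂ ] C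
&L₂-rule Γ Δ p = &L₂ {Γ = Γ} {Δ = Δ} (p tt)

*Lω-rule : ∀ {Ξ A C} → LeftRule Ξ Ξ (λ n → replicate n A) [ A * ] C
*Lω-rule Γ Δ p = *Lω {Γ = Γ} {Δ = Δ} p

!L-rule : ∀ {Ξ C} m → LeftRule (m ∷ Ξ) Ξ {⊤} (λ _ → []) [ ! m ] C
!L-rule m Γ Δ p = !L {Γ = Γ} {Δ = Δ} m ≈ˢ-refl (p tt)

Ad-rule : ∀ {Ξ C bs cs} → mi bs cs ∈ Ξ → LeftRule Ξ Ξ {⊤} (λ _ → vars cs) (vars bs) C
Ad-rule {bs = bs} {cs} m∈Ξ Γ Δ p = Ad {Γ = Γ} {Δ = Δ} bs cs (∈⇒≈ˢ∷ m∈Ξ) (p tt)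

\\L-rule : ∀ {Ξ Π A B C} → false ⊢ Ξ ∣ Π ⇒ A →
           LeftRule Ξ Ξ {⊤} (λ _ → [ B ]) (Π ++ [ A \\ B ]) C
\\L-rule {Π = Π} p Γ Δ q =
  cast (cong (Γ ++_) (sym (++-assoc Π _ Δ))) (\\L {Γ = Γ} {Π = Π} {Δ = Δ} p (q tt))

//L-rule : ∀ {Ξ Π A B C} → false ⊢ Ξ ∣ Π ⇒ A → LeftRule Ξ Ξ {⊤} (λ _ → [ B ]) ((B // A) ∷ Π) C
//L-rule p Γ Δ q = //L {Γ = Γ} {Δ = Δ} p (q tt)

permute : ∀ {Ξ' Ξ I Ys Xs C Γ₁ Δ₁ Γ A Δ Π} → LeftRule Ξ' Ξ {I} Ys Xs C →
          (∀ i G H → Γ₁ ++ Ys i ++ Δ₁ ≡ G ++ A ∷ H → false ⊢ Ξ' ∣ G ++ Π ++ H ⇒ C) →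
          Apart Xs Γ₁ Δ₁ Γ A Δ → false ⊢ Ξ ∣ Γ ++ Π ++ Δ ⇒ C
permute {Ys = Ys} {Xs} {Δ₁ = Δ₁} {Γ} {A} {Π = Π} rule ih (before M refl refl) =
  cast (++-assoc₄ Γ Π M (Xs ++ Δ₁)) (rule (Γ ++ Π ++ M) Δ₁ λ i →
    cast (sym (++-assoc₄ Γ Π M (Ys i ++ Δ₁)))
      (ih i Γ (M ++ Ys i ++ Δ₁) (++-assoc Γ (A ∷ M) (Ys i ++ Δ₁))))
permute {Ys = Ys} {Xs} {Γ₁ = Γ₁} {A = A} {Δ} {Π} rule ih (after M refl refl) =
  cast (sym (++-assoc₄ Γ₁ Xs M (Π ++ Δ))) (rule Γ₁ (M ++ Π ++ Δ) λ i →
    cast (++-assoc₄ Γ₁ (Ys i) M (Π ++ Δ))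
      (ih i (Γ₁ ++ Ys i ++ M) Δ (sym (++-assoc₄ Γ₁ (Ys i) M (A ∷ Δ)))))

inContext : ∀ {Ξ' Ξ I Ys Xs C} Γ Γ₁ Δ₁ Δ → LeftRule Ξ' Ξ {I} Ys Xs C →
            (∀ i → false ⊢ Ξ' ∣ Γ ++ (Γ₁ ++ Ys i ++ Δ₁) ++ Δ ⇒ C) →
            false ⊢ Ξ ∣ Γ ++ (Γ₁ ++ Xs ++ Δ₁) ++ Δ ⇒ C
inContext {Ys = Ys} {Xs} Γ Γ₁ Δ₁ Δ rule ih =
  cast (sym (++-frame Γ Γ₁ Xs Δ₁ Δ))
    (rule (Γ ++ Γ₁) (Δ₁ ++ Δ) λ i → cast (++-frame Γ Γ₁ (Ys i) Δ₁ Δ) (ih i))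

data RightIntro (Ξ : List MonImp) : List Formula → Formula → Set where
  1R  : RightIntro Ξ [] 𝟏
  *R0 : ∀ {A} → RightIntro Ξ [] (A *)
  \\R : ∀ {Π A B} → false ⊢ Ξ ∣ A ∷ Π ⇒ B → RightIntro Ξ Π (A \\ B)
  //R : ∀ {Π A B} → false ⊢ Ξ ∣ Π ++ [ A ] ⇒ B → RightIntro Ξ Π (B // A)
  ·R  : ∀ {Γ Δ A B} → false ⊢ Ξ ∣ Γ ⇒ A → false ⊢ Ξ ∣ Δ ⇒ B → RightIntro Ξ (Γ ++ Δ) (A · B)
  ⊕R₁ : ∀ {Π A₁ A₂} → false ⊢ Ξ ∣ Π ⇒ A₁ → RightIntro Ξ Π (A₁ ⊕ A₂)
  ⊕R₂ : ∀ {Π A₁ A₂} → false ⊢ Ξ ∣ Π ⇒ A₂ → RightIntro Ξ Π (A₁ ⊕ A₂)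
  &R  : ∀ {Π A₁ A₂} → false ⊢ Ξ ∣ Π ⇒ A₁ → false ⊢ Ξ ∣ Π ⇒ A₂ → RightIntro Ξ Π (A₁ & A₂)
  *Rn : ∀ {A} Π Πs → false ⊢ Ξ ∣ Π ⇒ A → All (λ Π′ → false ⊢ Ξ ∣ Π′ ⇒ A) Πs →
        RightIntro Ξ (Π ++ concat Πs) (A *)
  !R  : ∀ m → false ⊢ Ξ ∣ [] ⇒ ⌜ m ⌝ → RightIntro Ξ [] (! m)

fromRightIntro : ∀ {Ξ Π A} → RightIntro Ξ Π A → false ⊢ Ξ ∣ Π ⇒ A
fromRightIntro 1R              = 1R
fromRightIntro *R0             = *R0
fromRightIntro (\\R d)         = \\R d
fromRightIntro (//R d)         = //R d
fromRightIntro (·R d e)        = ·R d e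
fromRightIntro (⊕R₁ d)         = ⊕R₁ d
fromRightIntro (⊕R₂ d)         = ⊕R₂ d
fromRightIntro (&R d e)        = &R d e
fromRightIntro (*Rn Π Πs d ds) = *Rn Π Πs d ds
fromRightIntro (!R m d)        = !R m d

infixr 30 _·_
infixr 25 _\\_ _//_ _⊕_ _&_
infix 40 _*
infix 45 !_

-- Cuts are eliminated by recursion on Rank A rather than on A: a principal cut on ! m reduces
-- to cuts on ⌜ m ⌝, which is not a subformula of ! m.
data Rank : Formula → Set where
  var  : ∀ {n} → Rank (var n)
  𝟎    : Rank 𝟎
  𝟏    : Rank 𝟏
  _\\_ : ∀ {A B} → Rank A → Rank B → Rank (A \\ B)
  _//_ : ∀ {A B} → Rank A → Rank B → Rank (A // B)
  _·_  : ∀ {A B} → Rank A → Rank B → Rank (A · B)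
  _⊕_  : ∀ {A B} → Rank A → Rank B → Rank (A ⊕ B)
  _&_  : ∀ {A B} → Rank A → Rank B → Rank (A & B)
  _*   : ∀ {A} → Rank A → Rank (A *)
  !_   : ∀ {m} → Rank ⌜ m ⌝ → Rank (! m)

rank-prod : ∀ bs → Rank (prod bs)
rank-prod []            = 𝟏
rank-prod (b ∷ [])      = var
rank-prod (b ∷ b′ ∷ bs) = var · rank-prod (b′ ∷ bs)

rank⌜_⌝ : ∀ m → Rank ⌜ m ⌝
rank⌜ mi bs cs ⌝ = rank-prod bs \\ rank-prod cs

rank : ∀ A → Rank A
rank (var n)  = var
rank 𝟎        = 𝟎
rank 𝟏        = 𝟏
rank (A \\ B) = rank A \\ rank B
rank (A // B) = rank A // rank B
rank (A · B)  = rank A · rank B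
rank (A ⊕ B)  = rank A ⊕ rank B
rank (A & B)  = rank A & rank B
rank (A *)    = rank A *
rank (! m)    = ! rank⌜ m ⌝

-- The premises keep separate !-contexts, since commuting the cut past (A)_d or (!L)_d changes
-- only one of them.
CutAdmissible : Formula → Set
CutAdmissible A = ∀ {Ξ₁ Ξ₂ Ξ Π Θ C} → Ξ₁ ⊆ Ξ → Ξ₂ ⊆ Ξ →
  false ⊢ Ξ₁ ∣ Π ⇒ A → false ⊢ Ξ₂ ∣ Θ ⇒ C → ∀ Γ Δ → Θ ≡ Γ ++ A ∷ Δ →
  false ⊢ Ξ ∣ Γ ++ Π ++ Δ ⇒ C

cut-replicate : ∀ {A Ξ₁ Ξ₂ Ξ C Qs} → CutAdmissible A → Ξ₁ ⊆ Ξ → Ξ₂ ⊆ Ξ →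
                All (λ Q → false ⊢ Ξ₁ ∣ Q ⇒ A) Qs → ∀ Γ Δ →
                false ⊢ Ξ₂ ∣ Γ ++ replicate (length Qs) A ++ Δ ⇒ C →
                false ⊢ Ξ ∣ Γ ++ concat Qs ++ Δ ⇒ C
cut-replicate cutA s₁ s₂ [] Γ Δ d = weaken s₂ d
cut-replicate {A} cutA s₁ s₂ (_∷_ {x = Q} {xs = Qs} t ts) Γ Δ d =
  cast (trans (++-assoc Γ Q _) (cong (Γ ++_) (sym (++-assoc Q (concat Qs) Δ))))
    (cut-replicate cutA s₁ ⊆-refl ts (Γ ++ Q) Δ
      (cast (sym (++-assoc Γ Q _)) (cutA s₁ s₂ t d Γ (replicate (length Qs) A ++ Δ) refl)))

-- (A)_d for m is \L on ⌜ m ⌝ followed by a cut against the derivation of ⌜ m ⌝.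
cut⇒AdRuleAdmissible : ∀ {m Ξ} → CutAdmissible ⌜ m ⌝ → false ⊢ Ξ ∣ [] ⇒ ⌜ m ⌝ →
                       AdRuleAdmissible false Ξ m
cut⇒AdRuleAdmissible {mi bs cs} cut-m t s Γ Δ d =
  cast (++-assoc Γ (vars bs) Δ)
    (cut-m s ⊆-refl t (\\L {Γ = Γ} {Π = vars bs} {Δ = Δ} (prodR bs) (prodL cs Γ Δ d))
       (Γ ++ vars bs) Δ (sym (++-assoc Γ (vars bs) _)))

mutual
  cut : ∀ {A} → Rank A → CutAdmissible A
  cut ρ s₁ s₂ ax d Γ Δ eq      = cast eq (weaken s₂ d)
  cut ρ s₁ s₂ 1R               = cut-intro ρ s₁ s₂ 1R
  cut ρ s₁ s₂ *R0              = cut-intro ρ s₁ s₂ *R0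
  cut ρ s₁ s₂ (\\R t)          = cut-intro ρ s₁ s₂ (\\R t)
  cut ρ s₁ s₂ (//R t)          = cut-intro ρ s₁ s₂ (//R t)
  cut ρ s₁ s₂ (·R t u)         = cut-intro ρ s₁ s₂ (·R t u)
  cut ρ s₁ s₂ (⊕R₁ t)          = cut-intro ρ s₁ s₂ (⊕R₁ t)
  cut ρ s₁ s₂ (⊕R₂ t)          = cut-intro ρ s₁ s₂ (⊕R₂ t)
  cut ρ s₁ s₂ (&R t u)         = cut-intro ρ s₁ s₂ (&R t u)
  cut ρ s₁ s₂ (*Rn Π Πs t ts)  = cut-intro ρ s₁ s₂ (*Rn Π Πs t ts)
  cut ρ s₁ s₂ (!R m t)         = cut-intro ρ s₁ s₂ (!R m t)
  cut ρ s₁ s₂ (0L {Γ = Γ₁} {Δ = Δ₁}) d Γ Δ eq = inContext Γ Γ₁ Δ₁ Δ 0L-rule λ ()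
  cut ρ s₁ s₂ (1L {Γ = Γ₁} {Δ = Δ₁} p) d Γ Δ eq =
    inContext Γ Γ₁ Δ₁ Δ 1L-rule λ _ → cut ρ s₁ s₂ p d Γ Δ eq
  cut ρ s₁ s₂ (·L {Γ = Γ₁} {Δ = Δ₁} p) d Γ Δ eq =
    inContext Γ Γ₁ Δ₁ Δ ·L-rule λ _ → cut ρ s₁ s₂ p d Γ Δ eq
  cut ρ s₁ s₂ (⊕L {Γ = Γ₁} {Δ = Δ₁} p₁ p₂) d Γ Δ eq =
    inContext Γ Γ₁ Δ₁ Δ ⊕L-rule
      λ { true → cut ρ s₁ s₂ p₁ d Γ Δ eq ; false → cut ρ s₁ s₂ p₂ d Γ Δ eq }
  cut ρ s₁ s₂ (&L₁ {Γ = Γ₁} {Δ = Δ₁} p) d Γ Δ eq =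
    inContext Γ Γ₁ Δ₁ Δ &L₁-rule λ _ → cut ρ s₁ s₂ p d Γ Δ eq
  cut ρ s₁ s₂ (&L₂ {Γ = Γ₁} {Δ = Δ₁} p) d Γ Δ eq =
    inContext Γ Γ₁ Δ₁ Δ &L₂-rule λ _ → cut ρ s₁ s₂ p d Γ Δ eq
  cut ρ s₁ s₂ (*Lω {Γ = Γ₁} {Δ = Δ₁} f) d Γ Δ eq =
    inContext Γ Γ₁ Δ₁ Δ *Lω-rule λ n → cut ρ s₁ s₂ (f n) d Γ Δ eq
  cut ρ s₁ s₂ (\\L {Γ = Γ₁} {Π = Π₁} {Δ = Δ₁} p q) d Γ Δ eq =
    cast (cong (λ Θ → Γ ++ (Γ₁ ++ Θ) ++ Δ) (++-assoc Π₁ _ Δ₁))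
      (inContext Γ Γ₁ Δ₁ Δ (\\L-rule (weaken s₁ p)) λ _ → cut ρ s₁ s₂ q d Γ Δ eq)
  cut ρ s₁ s₂ (//L {Γ = Γ₁} {Δ = Δ₁} p q) d Γ Δ eq =
    inContext Γ Γ₁ Δ₁ Δ (//L-rule (weaken s₁ p)) λ _ → cut ρ s₁ s₂ q d Γ Δ eq
  cut ρ s₁ s₂ (!L {Γ = Γ₁} {Δ = Δ₁} m e p) d Γ Δ eq =
    inContext Γ Γ₁ Δ₁ Δ (!L-rule m) λ _ →
      cut ρ (≈ˢ∷⇒⊆∷ e s₁) (⊆-trans s₂ (xs⊆x∷xs _ m)) p d Γ Δ eq
  cut ρ s₁ s₂ (Ad {Γ = Γ₁} {Δ = Δ₁} bs cs e p) d Γ Δ eq =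
    inContext Γ Γ₁ Δ₁ Δ (Ad-rule (s₁ (≈ˢ∷⇒∈ e))) λ _ →
      cut ρ (⊆-trans (≈ˢ∷⇒⊇ e) s₁) s₂ p d Γ Δ eq

  cut-intro : ∀ {A Ξ₁ Ξ₂ Ξ Π Θ C} → Rank A → Ξ₁ ⊆ Ξ → Ξ₂ ⊆ Ξ → RightIntro Ξ₁ Π A →
              false ⊢ Ξ₂ ∣ Θ ⇒ C → ∀ Γ Δ → Θ ≡ Γ ++ A ∷ Δ → false ⊢ Ξ ∣ Γ ++ Π ++ Δ ⇒ C
  cut-intro ρ s₁ s₂ r ax [] []      refl = cast (sym (++-identityʳ _)) (weaken s₁ (fromRightIntro r))
  cut-intro ρ s₁ s₂ r ax [] (_ ∷ _) ()
  cut-intro ρ s₁ s₂ r ax (_ ∷ Γ) Δ  eq   = ⊥-elim ([]≢++∷ Γ (proj₂ (∷-injective eq)))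
  cut-intro ρ s₁ s₂ r 1R       Γ Δ eq = ⊥-elim ([]≢++∷ Γ eq)
  cut-intro ρ s₁ s₂ r *R0      Γ Δ eq = ⊥-elim ([]≢++∷ Γ eq)
  cut-intro ρ s₁ s₂ r (!R m _) Γ Δ eq = ⊥-elim ([]≢++∷ Γ eq)
  cut-intro ρ s₁ s₂ r (\\R {A = A₁} q) Γ Δ eq =
    \\R (cut-intro ρ s₁ s₂ r q (A₁ ∷ Γ) Δ (cong (A₁ ∷_) eq))
  cut-intro {A} {Π = Π} ρ s₁ s₂ r (//R {A = A₁} q) Γ Δ eq =
    //R (cast (sym (++-assoc₄ Γ Π Δ [ A₁ ]))
      (cut-intro ρ s₁ s₂ r q Γ (Δ ++ [ A₁ ])
        (trans (cong (_++ [ A₁ ]) eq) (++-assoc Γ (A ∷ Δ) [ A₁ ]))))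
  cut-intro ρ s₁ s₂ r (⊕R₁ q) Γ Δ eq = ⊕R₁ (cut-intro ρ s₁ s₂ r q Γ Δ eq)
  cut-intro ρ s₁ s₂ r (⊕R₂ q) Γ Δ eq = ⊕R₂ (cut-intro ρ s₁ s₂ r q Γ Δ eq)
  cut-intro ρ s₁ s₂ r (&R p q) Γ Δ eq =
    &R (cut-intro ρ s₁ s₂ r p Γ Δ eq) (cut-intro ρ s₁ s₂ r q Γ Δ eq)
  cut-intro {Π = Π} ρ s₁ s₂ r (·R {Γ = Γ₁} {Δ = Δ₁} p q) Γ Δ eq with split Γ₁ Δ₁ Γ _ Δ eq
  ... | before M refl refl =
    cast (++-assoc₄ Γ Π M Δ₁) (·R (cut-intro ρ s₁ s₂ r p Γ M refl) (weaken s₂ q))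
  ... | after M refl refl =
    cast (sym (++-assoc Γ₁ M (Π ++ Δ))) (·R (weaken s₂ p) (cut-intro ρ s₁ s₂ r q M Δ refl))
  cut-intro {Π = Π} ρ s₁ s₂ r (*Rn Π₁ Πs t ts) Γ Δ eq with split Π₁ (concat Πs) Γ _ Δ eq
  ... | before M refl refl =
    cast (++-assoc₄ Γ Π M (concat Πs))
      (*Rn (Γ ++ Π ++ M) Πs (cut-intro ρ s₁ s₂ r t Γ M refl) (All.map (weaken s₂) ts))
  ... | after M e refl with cut-intro-concat ρ s₁ s₂ r ts M Δ e
  ...   | Πs′ , ts′ , e′ =
    cast (trans (cong (Π₁ ++_) e′) (sym (++-assoc Π₁ M (Π ++ Δ))))
      (*Rn Π₁ Πs′ (weaken s₂ t) ts′)
  cut-intro ρ s₁ s₂ r (0L {Γ = Γ₁} {Δ = Δ₁}) Γ Δ eq with locate₁ Γ₁ Δ₁ Γ Δ eq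
  ... | inj₁ apart = permute 0L-rule (λ ()) apart
  ... | inj₂ (refl , refl , refl) with r
  ...   | ()
  cut-intro ρ s₁ s₂ r (1L {Γ = Γ₁} {Δ = Δ₁} q) Γ Δ eq with locate₁ Γ₁ Δ₁ Γ Δ eq
  ... | inj₁ apart = permute 1L-rule (λ _ → cut-intro ρ s₁ s₂ r q) apart
  ... | inj₂ (refl , refl , refl) with r
  ...   | 1R = weaken s₂ q
  cut-intro ρ s₁ s₂ r (·L {Γ = Γ₁} {Δ = Δ₁} {A = A₁} q) Γ Δ eq with locate₁ Γ₁ Δ₁ Γ Δ eq
  ... | inj₁ apart = permute ·L-rule (λ _ → cut-intro ρ s₁ s₂ r q) apart
  ... | inj₂ (refl , refl , refl) with r | ρ
  ...   | ·R {Γ = Γa} {Δ = Δa} t u | ρA · ρB =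
    cast (cong (Γ₁ ++_) (sym (++-assoc Γa Δa Δ₁)))
      (cut ρA s₁ ⊆-refl t
        (cut ρB s₁ s₂ u q (Γ₁ ++ [ A₁ ]) Δ₁ (sym (++-assoc Γ₁ [ A₁ ] _)))
        Γ₁ (Δa ++ Δ₁) (++-assoc Γ₁ [ A₁ ] _))
  cut-intro ρ s₁ s₂ r (⊕L {Γ = Γ₁} {Δ = Δ₁} q₁ q₂) Γ Δ eq with locate₁ Γ₁ Δ₁ Γ Δ eq
  ... | inj₁ apart =
    permute ⊕L-rule
      (λ { true → cut-intro ρ s₁ s₂ r q₁ ; false → cut-intro ρ s₁ s₂ r q₂ }) apart
  ... | inj₂ (refl , refl , refl) with r | ρ
  ...   | ⊕R₁ t | ρ₁ ⊕ _ = cut ρ₁ s₁ s₂ t q₁ Γ₁ Δ₁ refl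
  ...   | ⊕R₂ t | _ ⊕ ρ₂ = cut ρ₂ s₁ s₂ t q₂ Γ₁ Δ₁ refl
  cut-intro ρ s₁ s₂ r (&L₁ {Γ = Γ₁} {Δ = Δ₁} q) Γ Δ eq with locate₁ Γ₁ Δ₁ Γ Δ eq
  ... | inj₁ apart = permute &L₁-rule (λ _ → cut-intro ρ s₁ s₂ r q) apart
  ... | inj₂ (refl , refl , refl) with r | ρ
  ...   | &R t _ | ρ₁ & _ = cut ρ₁ s₁ s₂ t q Γ₁ Δ₁ refl
  cut-intro ρ s₁ s₂ r (&L₂ {Γ = Γ₁} {Δ = Δ₁} q) Γ Δ eq with locate₁ Γ₁ Δ₁ Γ Δ eq
  ... | inj₁ apart = permute &L₂-rule (λ _ → cut-intro ρ s₁ s₂ r q) apart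
  ... | inj₂ (refl , refl , refl) with r | ρ
  ...   | &R _ u | _ & ρ₂ = cut ρ₂ s₁ s₂ u q Γ₁ Δ₁ refl
  cut-intro ρ s₁ s₂ r (*Lω {Γ = Γ₁} {Δ = Δ₁} f) Γ Δ eq with locate₁ Γ₁ Δ₁ Γ Δ eq
  ... | inj₁ apart = permute *Lω-rule (λ n → cut-intro ρ s₁ s₂ r (f n)) apart
  ... | inj₂ (refl , refl , refl) with r | ρ
  ...   | *R0            | _    = weaken s₂ (f 0)
  ...   | *Rn Π₀ Πs t ts | ρA * =
    cut-replicate (cut ρA) s₁ s₂ (t ∷ ts) Γ₁ Δ₁ (f (length (Π₀ ∷ Πs)))
  cut-intro ρ s₁ s₂ r (!L {Γ = Γ₁} {Δ = Δ₁} m e q) Γ Δ eq with locate₁ Γ₁ Δ₁ Γ Δ eq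
  ... | inj₁ apart =
    permute (!L-rule m)
      (λ _ → cut-intro ρ (⊆-trans s₁ (xs⊆x∷xs _ m)) (≈ˢ∷⇒⊆∷ e s₂) r q) apart
  ... | inj₂ (refl , refl , refl) with r | ρ
  ...   | !R _ t | ! ρm =
    discharge (AdRuleAdmissible-mono s₁ (cut⇒AdRuleAdmissible (cut ρm) t)) (≈ˢ∷⇒⊆∷ e s₂) q
  cut-intro ρ s₁ s₂ r (Ad {Γ = Γ₁} {Δ = Δ₁} bs cs e q) Γ Δ eq
    with locate Γ₁ (vars bs) Δ₁ Γ _ Δ eq
  ... | inj₁ apart =
    permute (Ad-rule (s₂ (≈ˢ∷⇒∈ e)))
      (λ _ → cut-intro ρ s₁ (⊆-trans (≈ˢ∷⇒⊇ e) s₂) r q) apart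
  ... | inj₂ i with ∈-map⁻ var (inside⇒∈ i)
  ...   | _ , _ , refl with r
  ...     | ()
  cut-intro {Π = Π} ρ s₁ s₂ r (\\L {Γ = Γ₁} {Π = Π₁} {Δ = Δ₁} p q) Γ Δ eq
    with locate\\ Γ₁ Π₁ Δ₁ Γ Δ eq
  ... | inj₁ apart =
    permute (\\L-rule (weaken s₂ p)) (λ _ → cut-intro ρ s₁ s₂ r q) apart
  ... | inj₂ (inj₁ (inside M₁ M₂ refl refl refl)) =
    cast (++-frame Γ₁ M₁ Π M₂ _)
      (\\L {Γ = Γ₁} {Π = M₁ ++ Π ++ M₂} {Δ = Δ₁} (cut-intro ρ s₁ s₂ r p M₁ M₂ refl) (weaken s₂ q))
  ... | inj₂ (inj₂ (refl , refl , refl)) with r | ρ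
  ...   | \\R t | ρA \\ ρB =
    cast (trans (cong (Γ₁ ++_) (++-assoc Π₁ Π Δ₁)) (sym (++-assoc Γ₁ Π₁ _)))
      (cut ρB ⊆-refl s₂ (cut ρA s₂ s₁ p t [] Π refl) q Γ₁ Δ₁ refl)
  cut-intro {Π = Π} ρ s₁ s₂ r (//L {Γ = Γ₁} {Π = Π₁} {Δ = Δ₁} p q) Γ Δ eq
    with locate// Γ₁ Π₁ Δ₁ Γ Δ eq
  ... | inj₁ apart = permute (//L-rule (weaken s₂ p)) (λ _ → cut-intro ρ s₁ s₂ r q) apart
  ... | inj₂ (inj₁ (inside M₁ M₂ refl refl refl)) =
    cast (trans (sym (++-assoc Γ₁ [ _ ] _)) (++-frame (Γ₁ ++ [ _ ]) M₁ Π M₂ Δ₁))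
      (//L {Γ = Γ₁} {Π = M₁ ++ Π ++ M₂} {Δ = Δ₁} (cut-intro ρ s₁ s₂ r p M₁ M₂ refl) (weaken s₂ q))
  ... | inj₂ (inj₂ (refl , refl , refl)) with r | ρ
  ...   | //R t | ρB // ρA =
    cast (cong (Γ₁ ++_) (++-assoc₄ Π Π₁ [] Δ₁))
      (cut ρB ⊆-refl s₂ (cut ρA s₂ s₁ p t Π [] refl) q Γ₁ Δ₁ refl)

  cut-intro-concat : ∀ {A Ξ₁ Ξ₂ Ξ Π C Qs} → Rank A → Ξ₁ ⊆ Ξ → Ξ₂ ⊆ Ξ → RightIntro Ξ₁ Π A →
    All (λ Q → false ⊢ Ξ₂ ∣ Q ⇒ C) Qs → ∀ M Δ → concat Qs ≡ M ++ A ∷ Δ →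
    Σ[ Qs′ ∈ List (List Formula) ] All (λ Q → false ⊢ Ξ ∣ Q ⇒ C) Qs′ × concat Qs′ ≡ M ++ Π ++ Δ
  cut-intro-concat ρ s₁ s₂ r [] M Δ e = ⊥-elim ([]≢++∷ M e)
  cut-intro-concat {Π = Π} ρ s₁ s₂ r (_∷_ {x = Q} {xs = Qs} u us) M Δ e
    with split Q (concat Qs) M _ Δ e
  ... | before M′ refl refl =
    (M ++ Π ++ M′) ∷ Qs ,
    cut-intro ρ s₁ s₂ r u M M′ refl ∷ All.map (weaken s₂) us ,
    ++-assoc₄ M Π M′ (concat Qs)
  ... | after M′ e′ refl with cut-intro-concat ρ s₁ s₂ r us M′ Δ e′
  ...   | Qs′ , us′ , e″ =
    Q ∷ Qs′ , weaken s₂ u ∷ us′ , trans (cong (Q ++_) e″) (sym (++-assoc Q M′ (Π ++ Δ)))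

mutual
  eliminate : ∀ {Ξ Γ C} → true ⊢ Ξ ∣ Γ ⇒ C → false ⊢ Ξ ∣ Γ ⇒ C
  eliminate ax                                = ax
  eliminate 1R                                = 1R
  eliminate (0L {Γ = Γ} {Δ = Δ})              = 0L {Γ = Γ} {Δ = Δ}
  eliminate *R0                               = *R0
  eliminate (\\L {Γ = Γ} {Π = Π} {Δ = Δ} d e) =
    \\L {Γ = Γ} {Π = Π} {Δ = Δ} (eliminate d) (eliminate e)
  eliminate (\\R d)                           = \\R (eliminate d)
  eliminate (//L {Γ = Γ} {Π = Π} {Δ = Δ} d e) =
    //L {Γ = Γ} {Π = Π} {Δ = Δ} (eliminate d) (eliminate e)
  eliminate (//R d)                           = //R (eliminate d)
  eliminate (·L {Γ = Γ} {Δ = Δ} d)            = ·L {Γ = Γ} {Δ = Δ} (eliminate d)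
  eliminate (·R d e)                          = ·R (eliminate d) (eliminate e)
  eliminate (1L {Γ = Γ} {Δ = Δ} d)            = 1L {Γ = Γ} {Δ = Δ} (eliminate d)
  eliminate (⊕L {Γ = Γ} {Δ = Δ} d e)          = ⊕L {Γ = Γ} {Δ = Δ} (eliminate d) (eliminate e)
  eliminate (⊕R₁ d)                           = ⊕R₁ (eliminate d)
  eliminate (⊕R₂ d)                           = ⊕R₂ (eliminate d)
  eliminate (&L₁ {Γ = Γ} {Δ = Δ} d)           = &L₁ {Γ = Γ} {Δ = Δ} (eliminate d)
  eliminate (&L₂ {Γ = Γ} {Δ = Δ} d)           = &L₂ {Γ = Γ} {Δ = Δ} (eliminate d)
  eliminate (&R d e)                          = &R (eliminate d) (eliminate e)
  eliminate (*Lω {Γ = Γ} {Δ = Δ} f)           = *Lω {Γ = Γ} {Δ = Δ} (λ n → eliminate (f n))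
  eliminate (*Rn Π Πs d ds)                   = *Rn Π Πs (eliminate d) (eliminateAll ds)
  eliminate (!L {Γ = Γ} {Δ = Δ} m e d)        = !L {Γ = Γ} {Δ = Δ} m e (eliminate d)
  eliminate (!R m d)                          = !R m (eliminate d)
  eliminate (Ad {Γ = Γ} {Δ = Δ} bs cs e d)    = Ad {Γ = Γ} {Δ = Δ} bs cs e (eliminate d)
  eliminate (cut1 {Γ = Γ} {Δ = Δ} {A = A} d e) =
    cut (rank A) ⊆-refl ⊆-refl (eliminate d) (eliminate e) Γ Δ refl
  eliminate (cut2 m e d₁ d₂) =
    discharge (cut⇒AdRuleAdmissible (cut rank⌜ m ⌝) (eliminate d₁)) (≈ˢ⇒⊆ e) (eliminate d₂)

  eliminateAll : ∀ {Ξ Πs C} → All (λ Π → true ⊢ Ξ ∣ Π ⇒ C) Πs → All (λ Π → false ⊢ Ξ ∣ Π ⇒ C) Πs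
  eliminateAll []       = []
  eliminateAll (d ∷ ds) = eliminate d ∷ eliminateAll ds

proposition3p1 : (Ξ : List MonImp) (Γ : List Formula) (C : Formula) →
    Derivable Ξ Γ C → CutFreeDerivable Ξ Γ C
proposition3p1 Ξ Γ C = eliminate
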